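{- Let $K$ be a field of characteristic $0$ and let $z\in K$. Then $z$ is the root of a rooted infinite binary tree, in the sense defined in the context, if and only if $z$ is not a negative rational number.
   Context: Identify $\mathbb{Q}$ with the prime subfield of $K$. A negative rational number in $K$ is the image of a negative element of $\mathbb{Q}$. For $w\in K$, its right child is $w+1$ and its left child is $\frac{w}{w+1}$; the left child is defined only when $w\neq-1$. The element $z\in K$ is the root of a rooted infinite binary tree if the following construction never breaks down: starting from $z$, every vertex generated so far receives both children, and this is iterated indefinitely. Equivalently, $z$ is such a root if no element obtained from $z$ by finitely many applications of the two child operations equals $-1$. -}

module Defs where

open import Level using (Level; _⊔_; suc)
open import Algebra.Bundles using (CommutativeRing)
open import Data.Nat as ℕ using (ℕ; zero)
open import Data.Integer as ℤ using (ℤ; +_; -[1+_])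
open import Data.Rational as ℚ using (ℚ; ↥_; ↧ₙ_; _<_; 0ℚ)
open import Data.Product using (Σ; _×_; _,_)
open import Relation.Nullary using (¬_)
open import Relation.Binary.PropositionalEquality using (_≡_)
import Algebra.Properties.Group as GroupProps

record Field (c ℓ : Level) : Set (suc (c ⊔ ℓ)) where
  field
    commutativeRing : CommutativeRing c ℓ
  open CommutativeRing commutativeRing public
  field
    1≉0      : ¬ (1# ≈ 0#)
    inv      : (x : Carrier) → ¬ (x ≈ 0#) → Carrier
    inverseʳ : (x : Carrier) (x≉0 : ¬ (x ≈ 0#)) → (x * inv x x≉0) ≈ 1#

module _ {c ℓ} (F : Field c ℓ) where
  open Field F

  natCast : ℕ → Carrier
  natCast zero      = 0#
  natCast (ℕ.suc n) = 1# + natCast n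

  intCast : ℤ → Carrier
  intCast (+ n)      = natCast n
  intCast -[1+ n ]   = - natCast (ℕ.suc n)

  CharZero : Set ℓ
  CharZero = (n : ℕ) → ¬ (natCast (ℕ.suc n) ≈ 0#)

  ratCast : CharZero → ℚ → Carrier
  ratCast ch q = intCast (↥ q) * inv (natCast (↧ₙ q)) (ch (ℚ.denominator-1 q))

  IsNegRat : CharZero → Carrier → Set ℓ
  IsNegRat ch z = Σ ℚ λ q → (q < 0ℚ) × (ratCast ch q ≈ z)

  private
    module G = GroupProps +-group

  ≉-1⇒+1≉0 : (w : Carrier) → ¬ (w ≈ - 1#) → ¬ ((w + 1#) ≈ 0#)
  ≉-1⇒+1≉0 w ne eq = ne (G.x∙y⁻¹≈ε⇒x≈y w (- 1#)
    (trans (+-cong refl (G.⁻¹-involutive 1#)) eq))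

  leftChild : (w : Carrier) → ¬ (w ≈ - 1#) → Carrier
  leftChild w ne = w * inv (w + 1#) (≉-1⇒+1≉0 w ne)

  rightChild : Carrier → Carrier
  rightChild w = w + 1#

  data Reachable (z : Carrier) : Carrier → Set (c ⊔ ℓ) where
    here  : Reachable z z
    right : ∀ {w} → Reachable z w → Reachable z (rightChild w)
    left  : ∀ {w} → Reachable z w → (ne : ¬ (w ≈ - 1#)) → Reachable z (leftChild w ne)

  -- z is the root of a rooted infinite binary tree: the construction never
  -- breaks down, i.e. no element reachable from z equals -1
  IsTreeRoot : Carrier → Set (c ⊔ ℓ)
  IsTreeRoot z = ∀ w → Reachable z w → ¬ (w ≈ - 1#)

module Submission where

-- Let K be a field of characteristic 0.  The proof works with the explicit
-- form of a negative rational,  w = -(1+a)/(1+b)  with a, b ∈ ℕ, written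
-- NegFrac w a b  (i.e. (1+b)·w = -(1+a)).  The two child operations act on
-- these fractions like the subtractive Euclidean algorithm:
--
--   * w = -(1+b+1+c)/(1+b)   iff  w + 1       = -(1+c)/(1+b),
--   * w = -(1+a)/(1+a+1+c)   iff  w / (w + 1) = -(1+a)/(1+c),
--   * w = -(1+a)/(1+a)       iff  w = -1.
--
-- Reading these equivalences forwards, a negative fraction -(1+a)/(1+b)
-- reaches -1 after finitely many child steps (well-founded induction on
-- a + b), so no negative rational is a tree root.  Reading them backwards,
-- if -1 is reachable from z then z is a negative fraction.  It remains to
-- identify negative fractions with images of negative elements of ℚ.

open import Defs
open import Function.Bundles using (_⇔_; mk⇔; Equivalence)
open import Function.Properties.Equivalence using () renaming (sym to ⇔-sym; trans to ⇔-trans)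
open import Function.Related.Propositional using (module EquationalReasoning; equivalence)
open import Relation.Nullary using (¬_; contradiction)
open import Data.Product using (∃₂; _,_)
open import Relation.Binary.PropositionalEquality as ≡ using (_≡_)
open import Data.Nat as ℕ using (ℕ; suc; compare; less; equal; greater)
import Data.Nat.Properties as ℕP
open import Data.Nat.Induction using (<-wellFounded)
open import Induction.WellFounded using (Acc; acc)
open import Data.Integer as ℤ using (-[1+_])
import Data.Integer.Properties as ℤP
open import Data.Rational using (ℚ; mkℚ; toℚᵘ; fromℚᵘ)
import Data.Rational.Properties as ℚP
import Data.Rational.Unnormalised as ℚᵘ
import Algebra.Properties.Group as GroupProperties
import Algebra.Properties.Quasigroup as QuasigroupProperties
import Algebra.Properties.CommutativeSemigroup as CommSemigroupProperties
import Algebra.Properties.Ring as RingProperties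
import Algebra.Properties.Semiring.Mult as SemiringMultiplication
import Relation.Binary.Reasoning.Setoid as SetoidReasoning

open Equivalence using (to; from)

module FieldIdentities {c ℓ} (F : Field c ℓ) where
  open Field F
  open GroupProperties +-group using (\\-leftDividesˡ)
  open CommSemigroupProperties *-commutativeSemigroup using (x∙yz≈y∙xz)
  open RingProperties ring using (-‿distribʳ-*; -‿+-comm)
  open SetoidReasoning setoid

  *-cancelˡ : ∀ {t x y} → ¬ t ≈ 0# → t * x ≈ t * y → x ≈ y
  *-cancelˡ {t} {x} {y} t≉0 tx≈ty =
    trans (sym (unscale x)) (trans (*-congˡ tx≈ty) (unscale y))
    where
    t⁻¹ : Carrier
    t⁻¹ = inv t t≉0

    unscale : ∀ u → t⁻¹ * (t * u) ≈ u
    unscale u = begin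
      t⁻¹ * (t * u)  ≈⟨ *-assoc t⁻¹ t u ⟨
      (t⁻¹ * t) * u  ≈⟨ *-congʳ (trans (*-comm t⁻¹ t) (inverseʳ t t≉0)) ⟩
      1# * u         ≈⟨ *-identityˡ u ⟩
      u              ∎

  division-spec : ∀ t (t≉0 : ¬ t ≈ 0#) x → t * (x * inv t t≉0) ≈ x
  division-spec t t≉0 x = begin
    t * (x * inv t t≉0)  ≈⟨ x∙yz≈y∙xz t x (inv t t≉0) ⟩
    x * (t * inv t t≉0)  ≈⟨ *-congˡ (inverseʳ t t≉0) ⟩
    x * 1#               ≈⟨ *-identityʳ x ⟩
    x                    ∎

  rescale : ∀ {A B D K z} → ¬ B ≈ 0# → B * z ≈ - A → K * B ≈ A * D →
            D * z ≈ - K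
  rescale {A} {B} {D} {K} {z} B≉0 Bz≈-A KB≈AD = *-cancelˡ B≉0 (begin
    B * (D * z)  ≈⟨ x∙yz≈y∙xz B D z ⟩
    D * (B * z)  ≈⟨ *-congˡ Bz≈-A ⟩
    D * - A      ≈⟨ -‿distribʳ-* D A ⟨
    - (D * A)    ≈⟨ -‿cong (trans (*-comm D A) (sym KB≈AD)) ⟩
    - (K * B)    ≈⟨ -‿cong (*-comm K B) ⟩
    - (B * K)    ≈⟨ -‿distribʳ-* B K ⟩
    B * - K      ∎)

  times-minusOne : ∀ A → A * - 1# ≈ - A
  times-minusOne A = trans (sym (-‿distribʳ-* A 1#)) (-‿cong (*-identityʳ A))

  times-succ : ∀ B w → B + B * w ≈ B * (w + 1#)
  times-succ B w = begin
    B + B * w       ≈⟨ +-comm B (B * w) ⟩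
    B * w + B       ≈⟨ +-congˡ (*-identityʳ B) ⟨
    B * w + B * 1#  ≈⟨ distribˡ B w 1# ⟨
    B * (w + 1#)    ∎

  succ-times-neg : ∀ w A → (w + 1#) * - A ≈ - (A * w) + - A
  succ-times-neg w A = begin
    (w + 1#) * - A      ≈⟨ distribʳ (- A) w 1# ⟩
    w * - A + 1# * - A  ≈⟨ +-cong (sym (-‿distribʳ-* w A)) (*-identityˡ (- A)) ⟩
    - (w * A) + - A     ≈⟨ +-congʳ (-‿cong (*-comm w A)) ⟩
    - (A * w) + - A     ∎

  plus-neg-sum : ∀ B C → B + - (B + C) ≈ - C
  plus-neg-sum B C = trans (+-congˡ (sym (-‿+-comm B C))) (\\-leftDividesˡ B (- C))

module FieldEquivalences {c ℓ} (F : Field c ℓ) where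
  open Field F
  open FieldIdentities F
  open GroupProperties +-group using (\\-leftDividesˡ; quasigroup)
  open QuasigroupProperties quasigroup using () renaming (cancelˡ to +-cancelˡ)
  open CommSemigroupProperties *-commutativeSemigroup using (x∙yz≈y∙xz)
  open EquationalReasoning {k = equivalence}

  ≈⇔≈ : ∀ {x x′ y y′} → x ≈ x′ → y ≈ y′ → (x ≈ y) ⇔ (x′ ≈ y′)
  ≈⇔≈ x≈x′ y≈y′ =
    mk⇔ (λ x≈y → trans (sym x≈x′) (trans x≈y y≈y′))
        (λ x′≈y′ → trans x≈x′ (trans x′≈y′ (sym y≈y′)))

  +-cancelˡ⇔ : ∀ t {x y} → (x ≈ y) ⇔ (t + x ≈ t + y)
  +-cancelˡ⇔ t = mk⇔ +-congˡ (+-cancelˡ t _ _)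

  *-cancelˡ⇔ : ∀ {t} → ¬ t ≈ 0# → ∀ {x y} → (x ≈ y) ⇔ (t * x ≈ t * y)
  *-cancelˡ⇔ t≉0 = mk⇔ *-congˡ (*-cancelˡ t≉0)

  division⇔ : ∀ t (t≉0 : ¬ t ≈ 0#) x z → (x * inv t t≉0 ≈ z) ⇔ (t * z ≈ x)
  division⇔ t t≉0 x z = begin
    (x * inv t t≉0 ≈ z)            ∼⟨ *-cancelˡ⇔ t≉0 ⟩
    (t * (x * inv t t≉0) ≈ t * z)  ∼⟨ ≈⇔≈ (division-spec t t≉0 x) refl ⟩
    (x ≈ t * z)                    ∼⟨ mk⇔ sym sym ⟩
    (t * z ≈ x)                    ∎

  rightStep⇔ : ∀ B C w → (B * w ≈ - (B + C)) ⇔ (B * rightChild F w ≈ - C)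
  rightStep⇔ B C w = begin
    (B * w ≈ - (B + C))          ∼⟨ +-cancelˡ⇔ B ⟩
    (B + B * w ≈ B + - (B + C))  ∼⟨ ≈⇔≈ (times-succ B w) (plus-neg-sum B C) ⟩
    (B * (w + 1#) ≈ - C)         ∎

  leftStep⇔ : ∀ A C w (w≉-1 : ¬ w ≈ - 1#) →
              (C * leftChild F w w≉-1 ≈ - A) ⇔ ((A + C) * w ≈ - A)
  leftStep⇔ A C w w≉-1 = begin
    (C * w′ ≈ - A)                               ∼⟨ *-cancelˡ⇔ s≉0 ⟩
    (s * (C * w′) ≈ s * - A)                     ∼⟨ ≈⇔≈ times-child (succ-times-neg w A) ⟩
    (C * w ≈ - (A * w) + - A)                    ∼⟨ +-cancelˡ⇔ (A * w) ⟩
    (A * w + C * w ≈ A * w + (- (A * w) + - A))  ∼⟨ ≈⇔≈ (sym (distribʳ w A C))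
                                                        (\\-leftDividesˡ (A * w) (- A)) ⟩
    ((A + C) * w ≈ - A)                          ∎
    where
    s : Carrier
    s = w + 1#

    s≉0 : ¬ s ≈ 0#
    s≉0 = ≉-1⇒+1≉0 F w w≉-1

    w′ : Carrier
    w′ = leftChild F w w≉-1

    times-child : s * (C * w′) ≈ C * w
    times-child = trans (x∙yz≈y∙xz s C w′) (*-congˡ (division-spec s s≉0 w))

  diagonal⇔ : ∀ {A} → ¬ A ≈ 0# → ∀ w → (A * w ≈ - A) ⇔ (w ≈ - 1#)
  diagonal⇔ {A} A≉0 w = begin
    (A * w ≈ - A)       ∼⟨ ≈⇔≈ refl (sym (times-minusOne A)) ⟩
    (A * w ≈ A * - 1#)  ∼⟨ ⇔-sym (*-cancelˡ⇔ A≉0) ⟩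
    (w ≈ - 1#)          ∎

module NegativeFractions {c ℓ} (F : Field c ℓ) (ch : CharZero F) where
  open Field F
  open FieldIdentities F using (rescale)
  open FieldEquivalences F
  open GroupProperties +-group using (⁻¹-injective; quasigroup)
  open QuasigroupProperties quasigroup using () renaming (cancelˡ to +-cancelˡ)
  open SemiringMultiplication semiring using (_×_; ×-homo-+; ×1-homo-*)
  open SetoidReasoning setoid

  pos : ℕ → Carrier
  pos n = natCast F (suc n)

  NegFrac : Carrier → ℕ → ℕ → Set ℓ
  NegFrac w a b = pos b * w ≈ - pos a

  natCast≡× : ∀ n → natCast F n ≡ n × 1#
  natCast≡× ℕ.zero  = ≡.refl
  natCast≡× (suc n) = ≡.cong (1# +_) (natCast≡× n)

  natCast-+ : ∀ m n → natCast F (m ℕ.+ n) ≈ natCast F m + natCast F n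
  natCast-+ m n = begin
    natCast F (m ℕ.+ n)        ≡⟨ natCast≡× (m ℕ.+ n) ⟩
    (m ℕ.+ n) × 1#             ≈⟨ ×-homo-+ 1# m n ⟩
    m × 1# + n × 1#            ≡⟨ ≡.cong₂ _+_ (≡.sym (natCast≡× m)) (≡.sym (natCast≡× n)) ⟩
    natCast F m + natCast F n  ∎

  natCast-* : ∀ m n → natCast F (m ℕ.* n) ≈ natCast F m * natCast F n
  natCast-* m n = begin
    natCast F (m ℕ.* n)        ≡⟨ natCast≡× (m ℕ.* n) ⟩
    (m ℕ.* n) × 1#             ≈⟨ ×1-homo-* m n ⟩
    m × 1# * n × 1#            ≡⟨ ≡.cong₂ _*_ (≡.sym (natCast≡× m)) (≡.sym (natCast≡× n)) ⟩
    natCast F m * natCast F n  ∎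

  pos-+ : ∀ a b → pos (suc (a ℕ.+ b)) ≈ pos a + pos b
  pos-+ a b = begin
    pos (suc (a ℕ.+ b))          ≡⟨ ≡.cong pos (≡.sym (ℕP.+-suc a b)) ⟩
    natCast F (suc a ℕ.+ suc b)  ≈⟨ natCast-+ (suc a) (suc b) ⟩
    pos a + pos b                ∎

  rightStep : ∀ w b c → NegFrac w (suc (b ℕ.+ c)) b ⇔ NegFrac (rightChild F w) c b
  rightStep w b c =
    ⇔-trans (≈⇔≈ refl (-‿cong (pos-+ b c))) (rightStep⇔ (pos b) (pos c) w)

  leftStep : ∀ w a c (w≉-1 : ¬ w ≈ - 1#) →
             NegFrac w a (suc (a ℕ.+ c)) ⇔ NegFrac (leftChild F w w≉-1) a c
  leftStep w a c w≉-1 =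
    ⇔-trans (≈⇔≈ (*-congʳ (pos-+ a c)) refl) (⇔-sym (leftStep⇔ (pos a) (pos c) w w≉-1))

  diagonal : ∀ w a → NegFrac w a a ⇔ (w ≈ - 1#)
  diagonal w a = diagonal⇔ (ch a) w

  notMinusOne : ∀ {w} a c → NegFrac w a (suc (a ℕ.+ c)) → ¬ w ≈ - 1#
  notMinusOne {w} a c frac w≈-1 = ch c (+-cancelˡ (pos a) _ _ (begin
    pos a + pos c        ≈⟨ pos-+ a c ⟨
    pos (suc (a ℕ.+ c))  ≈⟨ ⁻¹-injective (trans (sym (from (diagonal w (suc (a ℕ.+ c))) w≈-1)) frac) ⟩
    pos a                ≈⟨ +-identityʳ (pos a) ⟨
    pos a + 0#           ∎))

  descend : ∀ {z} → IsTreeRoot F z → ∀ a b → Acc ℕ._<_ (a ℕ.+ b) →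
            ∀ {w} → Reachable F z w → ¬ NegFrac w a b
  descend root a b (acc smaller) {w} r frac with compare a b
  ... | equal .a = root w r (to (diagonal w a) frac)
  ... | greater .b c =
    descend root c b (smaller shrinks) (right r) (to (rightStep w b c) frac)
    where
    shrinks : c ℕ.+ b ℕ.< suc (b ℕ.+ c) ℕ.+ b
    shrinks = ℕ.s≤s (ℕP.≤-trans (ℕP.≤-reflexive (ℕP.+-comm c b)) (ℕP.m≤m+n (b ℕ.+ c) b))
  ... | less .a c =
    descend root a c (smaller shrinks) (left r w≉-1) (to (leftStep w a c w≉-1) frac)
    where
    w≉-1 : ¬ w ≈ - 1#
    w≉-1 = notMinusOne a c frac

    shrinks : a ℕ.+ c ℕ.< a ℕ.+ suc (a ℕ.+ c)
    shrinks = ℕP.m≤n+m (suc (a ℕ.+ c)) a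

  ascend : ∀ {z w} → Reachable F z w → ∃₂ (NegFrac w) → ∃₂ (NegFrac z)
  ascend here frac = frac
  ascend (right {w} r) (c , b , frac) =
    ascend r (suc (b ℕ.+ c) , b , from (rightStep w b c) frac)
  ascend (left {w} r w≉-1) (a , c , frac) =
    ascend r (a , suc (a ℕ.+ c) , from (leftStep w a c w≉-1) frac)

  negRat⇒negFrac : ∀ {z} → IsNegRat F ch z → ∃₂ (NegFrac z)
  negRat⇒negFrac (q@(mkℚ (ℤ.+ _) _ _) , q<0 , _) =
    contradiction (ℚP.<-≤-trans q<0 (ℚP.nonNegative⁻¹ q)) (ℚP.<-irrefl ≡.refl)
  negRat⇒negFrac {z} (mkℚ -[1+ k ] d _ , _ , q↦z) =
    k , d , to (division⇔ (pos d) (ch d) (- pos k) z) q↦z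

  negFrac⇒negRat : ∀ {z} a b → NegFrac z a b → IsNegRat F ch z
  negFrac⇒negRat {z} a b frac = reduced (fromℚᵘ p) (ℚP.toℚᵘ-fromℚᵘ p)
    where
    p : ℚᵘ.ℚᵘ
    p = ℚᵘ.mkℚᵘ -[1+ a ] b

    reduced : (q : ℚ) → toℚᵘ q ℚᵘ.≃ p → IsNegRat F ch z
    -- a nonnegative numerator cannot cross-multiply to a negative one
    reduced (mkℚ (ℤ.+ m) _ _) (ℚᵘ.*≡* cross) with ≡.trans (ℤP.pos-* m (suc b)) cross
    ... | ()
    -- cross-multiplication says (1+k)(1+b) = (1+a)(1+d)
    reduced q@(mkℚ -[1+ k ] d _) (ℚᵘ.*≡* cross) =
      q , ℚP.negative⁻¹ q , from (division⇔ (pos d) (ch d) (- pos k) z)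
        (rescale (ch b) frac (begin
          pos k * pos b                 ≈⟨ natCast-* (suc k) (suc b) ⟨
          natCast F (suc k ℕ.* suc b)   ≡⟨ ≡.cong pos (ℤP.-[1+-injective cross) ⟩
          natCast F (suc a ℕ.* suc d)   ≈⟨ natCast-* (suc a) (suc d) ⟩
          pos a * pos d                 ∎))

  treeRoot⇒notNegRat : ∀ {z} → IsTreeRoot F z → ¬ IsNegRat F ch z
  treeRoot⇒notNegRat root negRat with negRat⇒negFrac negRat
  ... | a , b , frac = descend root a b (<-wellFounded (a ℕ.+ b)) here frac

  notNegRat⇒treeRoot : ∀ {z} → ¬ IsNegRat F ch z → IsTreeRoot F z
  notNegRat⇒treeRoot notNegRat w r w≈-1 with ascend r (0 , 0 , from (diagonal w 0) w≈-1)
  ... | a , b , frac = notNegRat (negFrac⇒negRat a b frac)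

mainTheorem11 : ∀ {c ℓ} (F : Field c ℓ) (ch : CharZero F) (z : Field.Carrier F) →
    IsTreeRoot F z ⇔ (¬ IsNegRat F ch z)
mainTheorem11 F ch z = mk⇔ treeRoot⇒notNegRat notNegRat⇒treeRoot
  where open NegativeFractions F ch
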